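{- For every integer $k\geq 5$, there is an extremal overlap-free word of length $2^k$ over $\{\mathtt{0},\mathtt{1}\}$.
   Context: An overlap is a word $axaxa$ with $a$ a letter, $x$ possibly empty; a word is overlap-free if it has no overlap as a factor. An extension of a word $w$ over $\{\mathtt{0},\mathtt{1}\}$ is a word $w'aw''$ with $a\in\{\mathtt{0},\mathtt{1}\}$ and $w'w''=w$; $w$ is extremal overlap-free if it is overlap-free and every extension of $w$ contains an overlap. -}

module Defs where

open import Data.Bool using (Bool)
open import Data.List using (List; []; _∷_; _++_; [_])
open import Data.Product using (∃; ∃-syntax; _×_)
open import Relation.Nullary using (¬_)
open import Relation.Binary.PropositionalEquality using (_≡_)

-- Binary words: letters 0,1 represented by false,true.
Word : Set
Word = List Bool

Factor : Word → Word → Set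
Factor f w = ∃[ u ] ∃[ v ] (w ≡ u ++ f ++ v)

IsOverlap : Word → Set
IsOverlap f = ∃[ a ] ∃[ x ] (f ≡ a ∷ x ++ a ∷ x ++ [ a ])

ContainsOverlap : Word → Set
ContainsOverlap w = ∃[ f ] (Factor f w × IsOverlap f)

OverlapFree : Word → Set
OverlapFree w = ¬ ContainsOverlap w

Extension : Word → Word → Set
Extension e w = ∃[ w' ] ∃[ w'' ] ∃[ a ] (w' ++ w'' ≡ w × e ≡ w' ++ a ∷ w'')

ExtremalOverlapFree : Word → Set
ExtremalOverlapFree w = OverlapFree w × (∀ e → Extension e w → ContainsOverlap e)

module Submission where

-- Let μ be the Thue–Morse morphism 0 ↦ 01, 1 ↦ 10 and seed = yy with
-- y = 00101101.  The witness for 2^k is μ^(k-4)(seed).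
--  * Thue's lemma: if μ w contains an overlap then so does w (desubstitute
--    the occurrence block by block; parity of lengths excludes misaligned
--    cases).  Hence μ preserves overlap-freeness.
--  * Overlap containment, hence extremality, is decidable by searching all
--    cuts of a word; this settles by computation that μ(seed) (length 32)
--    is extremal overlap-free, and that a few short windows contain overlaps.
--  * An insertion into μ²Z lands, up to moving it to a 2-block boundary, in
--    the middle of a 4-block, between two 4-blocks, or at an end.  The first
--    two cases create an overlap in a short window, so μ²Z is extremal once
--    both end insertions are; for Z = μ^m(seed) they are, since seed is a
--    square whose halves start and end suitably.

open import Defs
open import Data.Bool using (Bool; true; false; not)
open import Data.Bool.Properties using (_≟_; not-involutive; not-¬; ¬-not)
open import Data.Empty using (⊥-elim)
open import Data.List using ([]; _∷_; _++_; [_]; length)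
open import Data.List.Properties
  using (++-assoc; ++-identityʳ; ∷-injective; ∷-injectiveˡ; ∷ʳ-injective; length-++)
open import Data.List.Reverse using (reverseView; []; _∶_∶ʳ_)
open import Data.Nat using (ℕ; zero; suc; _+_; _*_; _^_; _∸_; _≤_)
open import Data.Nat.Properties
  using (even≢odd; +-comm; *-assoc; *-suc; *-identityˡ; ^-distribˡ-+-*; m∸n+n≡m; ∸-monoˡ-≤; <⇒≤)
open import Data.Product using (∃-syntax; _×_; _,_; proj₁; proj₂)
open import Data.Sum using (_⊎_; inj₁; inj₂)
import Data.Sum as Sum
open import Relation.Nullary using (Dec; yes; no)
open import Relation.Nullary.Decidable
  using (map′; _×-dec_; _⊎-dec_; ¬?; True; toWitness; decidable-stable)
open import Relation.Binary.PropositionalEquality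
  using (_≡_; _≢_; refl; sym; trans; cong; cong₂; subst; module ≡-Reasoning)

overlap-++ : ∀ (a : Bool) x T → (a ∷ x ++ a ∷ x ++ [ a ]) ++ T ≡ a ∷ x ++ a ∷ x ++ a ∷ T
overlap-++ a x T =
  cong (a ∷_) (trans (++-assoc x (a ∷ x ++ [ a ]) T) (cong (λ t → x ++ a ∷ t) (++-assoc x [ a ] T)))

overlap-prefix : ∀ (a : Bool) x T → ContainsOverlap (a ∷ x ++ a ∷ x ++ a ∷ T)
overlap-prefix a x T = (a ∷ x ++ a ∷ x ++ [ a ]) , ([] , T , sym (overlap-++ a x T)) , (a , x , refl)

overlap-infix : ∀ A m B → ContainsOverlap m → ContainsOverlap (A ++ m ++ B)
overlap-infix A m B (f , (u , v , refl) , isOverlap) = f , (A ++ u , v ++ B , eq) , isOverlap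
  where
  open ≡-Reasoning
  eq : A ++ (u ++ f ++ v) ++ B ≡ (A ++ u) ++ f ++ v ++ B
  eq = begin
    A ++ (u ++ f ++ v) ++ B   ≡⟨ cong (A ++_) (++-assoc u (f ++ v) B) ⟩
    A ++ u ++ (f ++ v) ++ B   ≡⟨ cong (λ t → A ++ u ++ t) (++-assoc f v B) ⟩
    A ++ u ++ f ++ v ++ B     ≡⟨ sym (++-assoc A u (f ++ v ++ B)) ⟩
    (A ++ u) ++ f ++ v ++ B   ∎

overlap-left : ∀ A m → ContainsOverlap m → ContainsOverlap (A ++ m)
overlap-left A m co = subst ContainsOverlap (cong (A ++_) (++-identityʳ m)) (overlap-infix A m [] co)

overlap-around : ∀ A L c R B → ContainsOverlap (L ++ c ∷ R) → ContainsOverlap ((A ++ L) ++ c ∷ R ++ B)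
overlap-around A L c R B co = subst ContainsOverlap eq (overlap-infix A (L ++ c ∷ R) B co)
  where
  eq : A ++ (L ++ c ∷ R) ++ B ≡ (A ++ L) ++ c ∷ R ++ B
  eq = trans (cong (A ++_) (++-assoc L (c ∷ R) B)) (sym (++-assoc A L (c ∷ R ++ B)))

overlap-letter-square : ∀ c X T → ContainsOverlap (c ∷ (X ++ [ c ]) ++ (X ++ [ c ]) ++ T)
overlap-letter-square c X T = subst (λ t → ContainsOverlap (c ∷ t)) (sym eq) (overlap-prefix c X T)
  where
  eq : (X ++ [ c ]) ++ (X ++ [ c ]) ++ T ≡ X ++ c ∷ X ++ c ∷ T
  eq = trans (++-assoc X [ c ] _) (cong (λ t → X ++ c ∷ t) (++-assoc X [ c ] T))

μ : Word → Word
μ [] = []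
μ (b ∷ w) = b ∷ not b ∷ μ w

μ-++ : ∀ u v → μ (u ++ v) ≡ μ u ++ μ v
μ-++ [] v = refl
μ-++ (b ∷ u) v = cong (λ t → b ∷ not b ∷ t) (μ-++ u v)

length-μ : ∀ w → length (μ w) ≡ 2 * length w
length-μ [] = refl
length-μ (b ∷ w) = trans (cong (λ n → suc (suc n)) (length-μ w)) (sym (*-suc 2 (length w)))

μ-injective : ∀ s t → μ s ≡ μ t → s ≡ t
μ-injective [] [] eq = refl
μ-injective (b ∷ s) (c ∷ t) eq with ∷-injective eq
... | refl , eq′ = cong (b ∷_) (μ-injective s t (proj₂ (∷-injective eq′)))

-- μ-images have even length, so a μ-image is never a μ-image plus one letter.
μ≢μ∷ʳ : ∀ s t e → μ s ≢ μ t ++ [ e ]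
μ≢μ∷ʳ s t e eq = even≢odd (length s) (length t) (begin
  2 * length s            ≡⟨ sym (length-μ s) ⟩
  length (μ s)            ≡⟨ cong length eq ⟩
  length (μ t ++ [ e ])   ≡⟨ length-++ (μ t) ⟩
  length (μ t) + 1        ≡⟨ +-comm (length (μ t)) 1 ⟩
  suc (length (μ t))      ≡⟨ cong suc (length-μ t) ⟩
  suc (2 * length t)      ∎)
  where open ≡-Reasoning

∷μ≢μ : ∀ a s t → a ∷ μ s ≢ μ t
∷μ≢μ a s t eq = even≢odd (length t) (length s) (begin
  2 * length t         ≡⟨ sym (length-μ t) ⟩
  length (μ t)         ≡⟨ cong length (sym eq) ⟩
  suc (length (μ s))   ≡⟨ cong suc (length-μ s) ⟩
  suc (2 * length s)   ∎)
  where open ≡-Reasoning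

-- If a · μ s = μ t · e, the word alternates a, ¬a, a, …, so it ends with e = a.
shifted-μ-ends : ∀ a s t e → a ∷ μ s ≡ μ t ++ [ e ] → e ≡ a
shifted-μ-ends a [] [] e eq = sym (∷-injectiveˡ eq)
shifted-μ-ends a (y ∷ s) (x ∷ t) e eq with ∷-injective eq
... | refl , eq₁ with ∷-injective eq₁
... | refl , eq₂ = trans (shifted-μ-ends (not y) s t e eq₂) (not-involutive a)

data μ-Cut (w A B : Word) : Set where
  between : ∀ u v → w ≡ u ++ v → A ≡ μ u → B ≡ μ v → μ-Cut w A B
  inside  : ∀ u b v → w ≡ u ++ b ∷ v → A ≡ μ u ++ [ b ] → B ≡ not b ∷ μ v → μ-Cut w A B

μ-cut : ∀ w A B → μ w ≡ A ++ B → μ-Cut w A B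
μ-cut w [] B eq = between [] w refl refl (sym eq)
μ-cut (b ∷ w) (c ∷ []) B eq with ∷-injective eq
... | refl , eq′ = inside [] b w refl refl (sym eq′)
μ-cut (b ∷ w) (c ∷ d ∷ A) B eq with ∷-injective eq
... | refl , eq₁ with ∷-injective eq₁
... | refl , eq₂ with μ-cut w A B eq₂
... | between u v p q r = between (b ∷ u) v (cong (b ∷_) p) (cong (λ t → b ∷ not b ∷ t) q) r
... | inside u e v p q r = inside (b ∷ u) e v (cong (b ∷_) p) (cong (λ t → b ∷ not b ∷ t) q) r

-- An overlap a x a x a at the start of μ v: |ax| must be even, and
-- desubstituting gives an overlap at the start of v.
even-overlap : ∀ v a x S → μ v ≡ a ∷ x ++ a ∷ x ++ a ∷ S → ContainsOverlap v
even-overlap v a x S eq with μ-cut v (a ∷ x) (a ∷ x ++ a ∷ S) eq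
... | inside t e r refl p q with ∷-injective q
...   | a≡¬e , q′ with μ-cut r x (a ∷ S) (sym q′)
...     | between t′ _ refl p′ _ =
            ⊥-elim (not-¬ (sym (shifted-μ-ends a t′ t e (trans (cong (a ∷_) (sym p′)) p))) a≡¬e)
...     | inside t′ e′ _ refl p′ _ =
            ⊥-elim (∷μ≢μ a t′ t (proj₁ (∷ʳ-injective (a ∷ μ t′) (μ t) (trans (cong (a ∷_) (sym p′)) p))))
even-overlap v a x S eq | between s r refl p q with μ-cut r (a ∷ x) (a ∷ S) (sym q)
... | inside t e _ refl p′ _ = ⊥-elim (μ≢μ∷ʳ s t e (trans (sym p) p′))
... | between s′ (a′ ∷ r′) refl p′ q′ with μ-injective s s′ (trans (sym p) p′) | ∷-injective q′
...   | refl | refl , _ with s | p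
...     | a₀ ∷ s₁ | refl = overlap-prefix a₀ s₁ r′

-- An overlap a x a x a at position 1 of μ(b v), where b = ¬a: again |ax|
-- must be even, and the overlap lifts to one at the start of b v.
odd-overlap : ∀ v a x S → μ v ≡ x ++ a ∷ x ++ a ∷ S → ContainsOverlap (not a ∷ v)
odd-overlap v a x S eq with μ-cut v x (a ∷ x ++ a ∷ S) eq
... | between q r refl p p₁ with μ-cut r (a ∷ x) (a ∷ S) (sym p₁)
...   | between s _ refl p′ _ = ⊥-elim (∷μ≢μ a q s (trans (cong (a ∷_) (sym p)) p′))
...   | inside t e _ refl p′ q′ =
          ⊥-elim (not-¬ (sym (shifted-μ-ends a q t e (trans (cong (a ∷_) (sym p)) p′))) (∷-injectiveˡ q′))
odd-overlap v a x S eq | inside q e r refl p p₁ with ∷-injective p₁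
... | refl , p₂ with μ-cut r x (not e ∷ S) (sym p₂)
...   | between q′ _ refl p′ _ = ⊥-elim (μ≢μ∷ʳ q′ q e (trans (sym p′) p))
...   | inside q′ e′ r′ refl p′ _ with ∷ʳ-injective (μ q) (μ q′) (trans (sym p) p′)
...     | μq≡μq′ , refl with μ-injective q q′ μq≡μq′
...       | refl = subst (λ c → ContainsOverlap (c ∷ q ++ e ∷ q ++ e ∷ r′))
                     (sym (not-involutive e)) (overlap-prefix e q r′)

-- Thue's lemma: an overlap in μ w lifts to w, by the parity of its start.
thue : ∀ w → ContainsOverlap (μ w) → ContainsOverlap w
thue w (_ , (u , v , eq) , (a , x , refl))
  with μ-cut w u (a ∷ x ++ a ∷ x ++ a ∷ v) (trans eq (cong (u ++_) (overlap-++ a x v)))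
... | between w₁ w₂ refl _ q = overlap-left w₁ w₂ (even-overlap w₂ a x v (sym q))
... | inside w₁ b w₂ refl _ q with ∷-injective q
...   | refl , q′ = subst (λ c → ContainsOverlap (w₁ ++ c ∷ w₂)) (not-involutive b)
                      (overlap-left w₁ _ (odd-overlap w₂ (not b) x v (sym q′)))

μ-overlapFree : ∀ w → OverlapFree w → OverlapFree (μ w)
μ-overlapFree w overlapFree co = overlapFree (thue w co)

Cut : (Word → Word → Set) → Word → Set
Cut P w = ∃[ u ] ∃[ v ] (w ≡ u ++ v × P u v)

cut? : ∀ {P : Word → Word → Set} → (∀ u v → Dec (P u v)) → ∀ w → Dec (Cut P w)
cut? {P} P? [] = map′ (λ p → [] , [] , refl , p) atEmpty (P? [] [])
  where
  atEmpty : Cut P [] → P [] []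
  atEmpty ([] , [] , refl , p) = p
cut? {P} P? (b ∷ w) = map′ join split (P? [] (b ∷ w) ⊎-dec cut? (λ u v → P? (b ∷ u) v) w)
  where
  join : P [] (b ∷ w) ⊎ Cut (λ u v → P (b ∷ u) v) w → Cut P (b ∷ w)
  join (inj₁ p) = [] , b ∷ w , refl , p
  join (inj₂ (u , v , refl , p)) = b ∷ u , v , refl , p
  split : Cut P (b ∷ w) → P [] (b ∷ w) ⊎ Cut (λ u v → P (b ∷ u) v) w
  split ([] , v , refl , p) = inj₁ p
  split (c ∷ u , v , refl , p) = inj₂ (u , v , refl , p)

allCuts? : ∀ {P : Word → Word → Set} → (∀ u v → Dec (P u v)) → ∀ w → Dec (∀ u v → u ++ v ≡ w → P u v)
allCuts? P? w with cut? (λ u v → ¬? (P? u v)) w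
... | yes (u , v , eq , ¬p) = no (λ all → ¬p (all u v (sym eq)))
... | no noCounterexample =
  yes (λ u v eq → decidable-stable (P? u v) (λ ¬p → noCounterexample (u , v , sym eq , ¬p)))

prefix? : ∀ p l → Dec (∃[ T ] (l ≡ p ++ T))
prefix? [] l = yes (l , refl)
prefix? (x ∷ p) [] = no λ { (T , ()) }
prefix? (x ∷ p) (y ∷ l) with x ≟ y
... | no x≢y = no λ { (T , eq) → x≢y (sym (∷-injectiveˡ eq)) }
... | yes refl = map′ (λ { (T , eq) → T , cong (x ∷_) eq }) (λ { (T , eq) → T , proj₂ (∷-injective eq) }) (prefix? p l)

OverlapPrefix : Word → Set
OverlapPrefix l = ∃[ a ] ∃[ x ] ∃[ T ] (l ≡ a ∷ x ++ a ∷ x ++ a ∷ T)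

-- a r starts with an overlap iff r = x r' where r' starts with a x a.
overlapPrefix? : ∀ l → Dec (OverlapPrefix l)
overlapPrefix? [] = no λ { (a , x , T , ()) }
overlapPrefix? (a ∷ r) = map′ found search (cut? (λ x r′ → prefix? (a ∷ x ++ [ a ]) r′) r)
  where
  found : Cut (λ x r′ → ∃[ T ] (r′ ≡ (a ∷ x ++ [ a ]) ++ T)) r → OverlapPrefix (a ∷ r)
  found (x , _ , refl , T , refl) = a , x , T , cong (λ t → a ∷ x ++ t) (++-assoc (a ∷ x) [ a ] T)
  search : OverlapPrefix (a ∷ r) → Cut (λ x r′ → ∃[ T ] (r′ ≡ (a ∷ x ++ [ a ]) ++ T)) r
  search (_ , x , T , refl) = x , a ∷ x ++ a ∷ T , refl , T , sym (++-assoc (a ∷ x) [ a ] T)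

-- A word contains an overlap iff one of its suffixes starts with one.
containsOverlap? : ∀ w → Dec (ContainsOverlap w)
containsOverlap? w = map′ found search (cut? (λ _ v → overlapPrefix? v) w)
  where
  found : Cut (λ _ v → OverlapPrefix v) w → ContainsOverlap w
  found (u , _ , refl , a , x , T , refl) = overlap-left u _ (overlap-prefix a x T)
  search : ContainsOverlap w → Cut (λ _ v → OverlapPrefix v) w
  search (_ , (u , v , refl) , a , x , refl) = u , _ , refl , a , x , v , overlap-++ a x v

extensionsOverlap? : ∀ w → Dec (∀ e → Extension e w → ContainsOverlap e)
extensionsOverlap? w = map′ fromCuts toCuts (allCuts? bothLetters? w)
  where
  bothLetters? : ∀ u v → Dec (ContainsOverlap (u ++ false ∷ v) × ContainsOverlap (u ++ true ∷ v))
  bothLetters? u v = containsOverlap? (u ++ false ∷ v) ×-dec containsOverlap? (u ++ true ∷ v)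
  fromCuts : (∀ u v → u ++ v ≡ w → ContainsOverlap (u ++ false ∷ v) × ContainsOverlap (u ++ true ∷ v))
           → ∀ e → Extension e w → ContainsOverlap e
  fromCuts all _ (u , v , false , eq , refl) = proj₁ (all u v eq)
  fromCuts all _ (u , v , true , eq , refl) = proj₂ (all u v eq)
  toCuts : (∀ e → Extension e w → ContainsOverlap e)
         → ∀ u v → u ++ v ≡ w → ContainsOverlap (u ++ false ∷ v) × ContainsOverlap (u ++ true ∷ v)
  toCuts ext u v eq = ext _ (u , v , false , eq , refl) , ext _ (u , v , true , eq , refl)

extremalOverlapFree? : ∀ w → Dec (ExtremalOverlapFree w)
extremalOverlapFree? w = ¬? (containsOverlap? w) ×-dec extensionsOverlap? w

overlap-by-search : (w : Word) → {True (containsOverlap? w)} → ContainsOverlap w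
overlap-by-search w {found} = toWitness found

-- Inserting a inside the block b ¬b: b a ¬b is b·(b ¬b) if a = b, and
-- (b ¬b)·¬b otherwise; either way the letter sits at a block boundary.
insertion-inside-block : ∀ u b a v → ∃[ u′ ] ∃[ v′ ] ∃[ c ]
  (u′ ++ v′ ≡ u ++ b ∷ v × (μ u ++ [ b ]) ++ a ∷ not b ∷ μ v ≡ μ u′ ++ c ∷ μ v′)
insertion-inside-block u b a v with a ≟ b
... | yes refl = u , b ∷ v , b , refl , ++-assoc (μ u) [ b ] _
... | no a≢b = u ++ [ b ] , v , not b , ++-assoc u [ b ] v , eq
  where
  open ≡-Reasoning
  eq : (μ u ++ [ b ]) ++ a ∷ not b ∷ μ v ≡ μ (u ++ [ b ]) ++ not b ∷ μ v
  eq = begin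
    (μ u ++ [ b ]) ++ a ∷ not b ∷ μ v      ≡⟨ ++-assoc (μ u) [ b ] _ ⟩
    μ u ++ b ∷ a ∷ not b ∷ μ v             ≡⟨ cong (λ t → μ u ++ b ∷ t ∷ not b ∷ μ v) (¬-not a≢b) ⟩
    μ u ++ b ∷ not b ∷ not b ∷ μ v         ≡⟨ sym (++-assoc (μ u) (μ [ b ]) _) ⟩
    (μ u ++ μ [ b ]) ++ not b ∷ μ v        ≡⟨ cong (_++ not b ∷ μ v) (sym (μ-++ u [ b ])) ⟩
    μ (u ++ [ b ]) ++ not b ∷ μ v          ∎

μ-extension : ∀ e Y → Extension e (μ Y) → ∃[ u ] ∃[ v ] ∃[ c ] (u ++ v ≡ Y × e ≡ μ u ++ c ∷ μ v)
μ-extension e Y (w′ , w″ , a , eq , refl) with μ-cut Y w′ w″ (sym eq)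
... | between u v refl refl refl = u , v , a , refl , refl
... | inside u b v refl refl refl = insertion-inside-block u b a v

inside-block-window : ∀ b c → ContainsOverlap (μ [ b ] ++ c ∷ μ [ not b ])
inside-block-window false false = overlap-by-search _
inside-block-window false true  = overlap-by-search _
inside-block-window true  false = overlap-by-search _
inside-block-window true  true  = overlap-by-search _

between-blocks-window : ∀ z c z′ → ContainsOverlap (μ (μ [ z ]) ++ c ∷ μ (μ [ z′ ]))
between-blocks-window false false false = overlap-by-search _
between-blocks-window false false true  = overlap-by-search _
between-blocks-window false true  false = overlap-by-search _
between-blocks-window false true  true  = overlap-by-search _
between-blocks-window true  false false = overlap-by-search _
between-blocks-window true  false true  = overlap-by-search _
between-blocks-window true  true  false = overlap-by-search _
between-blocks-window true  true  true  = overlap-by-search _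

μ^ : ℕ → Word → Word
μ^ zero w = w
μ^ (suc n) w = μ (μ^ n w)

μ^-++ : ∀ n u v → μ^ n (u ++ v) ≡ μ^ n u ++ μ^ n v
μ^-++ zero u v = refl
μ^-++ (suc n) u v = trans (cong μ (μ^-++ n u v)) (μ-++ (μ^ n u) (μ^ n v))

-- Every extension of μ²Z contains an overlap as soon as the insertions at
-- both ends do: all inner insertions do so by the two window lemmas.
μ²-extensions : ∀ Z → (∀ c → ContainsOverlap (c ∷ μ (μ Z))) → (∀ c → ContainsOverlap (μ (μ Z) ++ [ c ]))
              → ∀ e → Extension e (μ (μ Z)) → ContainsOverlap e
μ²-extensions Z prepend append e ext with μ-extension e (μ Z) ext
... | u , v , c , uv , refl with μ-cut Z u v (sym uv)
... | inside u₁ b v₁ refl refl refl =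
  subst (λ t → ContainsOverlap (t ++ c ∷ μ (not b ∷ μ v₁))) (sym (μ-++ (μ u₁) [ b ]))
    (overlap-around (μ (μ u₁)) (μ [ b ]) c (μ [ not b ]) (μ (μ v₁)) (inside-block-window b c))
... | between u₁ v₁ refl refl refl with reverseView u₁ | v₁
...   | [] | _ = prepend c
...   | u₁′ ∶ _ ∶ʳ z | [] =
  subst (λ t → ContainsOverlap (μ (μ t) ++ [ c ])) (++-identityʳ (u₁′ ++ [ z ])) (append c)
...   | u₁′ ∶ _ ∶ʳ z | z′ ∷ v₁′ =
  subst (λ t → ContainsOverlap (t ++ c ∷ μ (μ (z′ ∷ v₁′)))) (sym (μ^-++ 2 u₁′ [ z ]))
    (overlap-around (μ (μ u₁′)) (μ (μ [ z ])) c (μ (μ [ z′ ])) (μ (μ v₁′)) (between-blocks-window z c z′))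

length-μ^ : ∀ n w → length (μ^ n w) ≡ 2 ^ n * length w
length-μ^ zero w = sym (*-identityˡ (length w))
length-μ^ (suc n) w = begin
  length (μ (μ^ n w))        ≡⟨ length-μ (μ^ n w) ⟩
  2 * length (μ^ n w)        ≡⟨ cong (2 *_) (length-μ^ n w) ⟩
  2 * (2 ^ n * length w)     ≡⟨ sym (*-assoc 2 (2 ^ n) (length w)) ⟩
  2 ^ suc n * length w       ∎
  where open ≡-Reasoning

μ^-head : ∀ n b r → ∃[ T ] (μ^ n (b ∷ r) ≡ b ∷ T)
μ^-head zero b r = r , refl
μ^-head (suc n) b r with μ^-head n b r
... | T , eq = _ , cong μ eq

-- b flipped n times: the last letter of μⁿ b.
flips : ℕ → Bool → Bool
flips zero b = b
flips (suc n) b = not (flips n b)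

μ^-last : ∀ n b → ∃[ A ] (μ^ n [ b ] ≡ A ++ [ flips n b ])
μ^-last zero b = [] , refl
μ^-last (suc n) b with μ^-last n b
... | A , eq = μ A ++ [ flips n b ] ,
  trans (cong μ eq) (trans (μ-++ A [ flips n b ]) (sym (++-assoc (μ A) [ flips n b ] [ not (flips n b) ])))

last-letter-dichotomy : ∀ n c → c ≡ flips n true ⊎ c ≡ flips n false
last-letter-dichotomy n c = Sum.map₂ (λ eq → trans eq (sym (flips-not n))) (letter-or-not c (flips n true))
  where
  letter-or-not : ∀ c d → c ≡ d ⊎ c ≡ not d
  letter-or-not false false = inj₁ refl
  letter-or-not false true  = inj₂ refl
  letter-or-not true  false = inj₂ refl
  letter-or-not true  true  = inj₁ refl
  flips-not : ∀ n → flips n false ≡ not (flips n true)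
  flips-not zero = refl
  flips-not (suc n) = cong not (flips-not n)

prepend-square : ∀ n p b r → ContainsOverlap (flips n b ∷ μ^ n ((p ++ [ b ]) ++ (p ++ [ b ]) ++ r))
prepend-square n p b r with μ^-last n b
... | A , eqA = subst (λ t → ContainsOverlap (flips n b ∷ t)) (sym eq)
                  (overlap-letter-square (flips n b) (μ^ n p ++ A) (μ^ n r))
  where
  half : μ^ n (p ++ [ b ]) ≡ (μ^ n p ++ A) ++ [ flips n b ]
  half = trans (μ^-++ n p [ b ]) (trans (cong (μ^ n p ++_) eqA) (sym (++-assoc (μ^ n p) A _)))
  eq : μ^ n ((p ++ [ b ]) ++ (p ++ [ b ]) ++ r)
     ≡ ((μ^ n p ++ A) ++ [ flips n b ]) ++ ((μ^ n p ++ A) ++ [ flips n b ]) ++ μ^ n r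
  eq = trans (μ^-++ n (p ++ [ b ]) _)
         (trans (cong (μ^ n (p ++ [ b ]) ++_) (μ^-++ n (p ++ [ b ]) r))
           (cong₂ (λ s t → s ++ t ++ μ^ n r) half half))

append-square : ∀ n q a p → ContainsOverlap (μ^ n (q ++ (a ∷ p) ++ (a ∷ p)) ++ [ a ])
append-square n q a p with μ^-head n a p
... | T , eqT = subst ContainsOverlap (sym eq) (overlap-left (μ^ n q) _ (overlap-prefix a T []))
  where
  open ≡-Reasoning
  eq : μ^ n (q ++ (a ∷ p) ++ (a ∷ p)) ++ [ a ] ≡ μ^ n q ++ (a ∷ T ++ a ∷ T ++ [ a ])
  eq = begin
    μ^ n (q ++ (a ∷ p) ++ (a ∷ p)) ++ [ a ]
      ≡⟨ cong (_++ [ a ]) (μ^-++ n q _) ⟩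
    (μ^ n q ++ μ^ n ((a ∷ p) ++ (a ∷ p))) ++ [ a ]
      ≡⟨ cong (λ t → (μ^ n q ++ t) ++ [ a ]) (μ^-++ n (a ∷ p) (a ∷ p)) ⟩
    (μ^ n q ++ μ^ n (a ∷ p) ++ μ^ n (a ∷ p)) ++ [ a ]
      ≡⟨ cong (λ t → (μ^ n q ++ t ++ t) ++ [ a ]) eqT ⟩
    (μ^ n q ++ (a ∷ T) ++ (a ∷ T)) ++ [ a ]
      ≡⟨ ++-assoc (μ^ n q) _ [ a ] ⟩
    μ^ n q ++ ((a ∷ T) ++ (a ∷ T)) ++ [ a ]
      ≡⟨ cong (μ^ n q ++_) (++-assoc (a ∷ T) (a ∷ T) [ a ]) ⟩
    μ^ n q ++ (a ∷ T ++ a ∷ T ++ [ a ])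
      ∎

seed : Word
seed = y ++ y
  where
  y : Word
  y = false ∷ false ∷ true ∷ false ∷ true ∷ true ∷ false ∷ true ∷ []

-- seed = (y′1)(y′1) = (0)(0)r: its halves end with 1, and it starts with 00.
prepend-seed : ∀ n c → ContainsOverlap (c ∷ μ^ n seed)
prepend-seed n c with last-letter-dichotomy n c
... | inj₁ refl = prepend-square n (false ∷ false ∷ true ∷ false ∷ true ∷ true ∷ false ∷ []) true []
... | inj₂ refl = prepend-square n [] false
  (true ∷ false ∷ true ∷ true ∷ false ∷ true ∷ false ∷ false ∷ true ∷ false ∷ true ∷ true ∷ false ∷ true ∷ [])

-- seed = (0p)(0p) = q(1 01)(1 01).
append-seed : ∀ n c → ContainsOverlap (μ^ n seed ++ [ c ])
append-seed n false = append-square n [] false (false ∷ true ∷ false ∷ true ∷ true ∷ false ∷ true ∷ [])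
append-seed n true =
  append-square n (false ∷ false ∷ true ∷ false ∷ true ∷ true ∷ false ∷ true ∷ false ∷ false ∷ []) true (false ∷ true ∷ [])

μ-seed-extremal : ExtremalOverlapFree (μ seed)
μ-seed-extremal = toWitness {a? = extremalOverlapFree? (μ seed)} _

overlapFree-μ^-seed : ∀ m → OverlapFree (μ^ (suc m) seed)
overlapFree-μ^-seed zero = proj₁ μ-seed-extremal
overlapFree-μ^-seed (suc m) = μ-overlapFree (μ^ (suc m) seed) (overlapFree-μ^-seed m)

extremal-μ^-seed : ∀ m → 1 ≤ m → ExtremalOverlapFree (μ^ m seed)
extremal-μ^-seed (suc zero) _ = μ-seed-extremal
extremal-μ^-seed (suc (suc m)) _ =
  overlapFree-μ^-seed (suc m) , μ²-extensions (μ^ m seed) (prepend-seed (2 + m)) (append-seed (2 + m))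

-- |seed| = 16, so |μᵐ(seed)| = 2^(m+4).
length-μ^-seed : ∀ m → length (μ^ m seed) ≡ 2 ^ (m + 4)
length-μ^-seed m = trans (length-μ^ m seed) (sym (^-distribˡ-+-* 2 m 4))

lemma2p7 : (k : ℕ) → 5 ≤ k → ∃[ w ] (length w ≡ 2 ^ k × ExtremalOverlapFree w)
lemma2p7 k 5≤k =
  μ^ (k ∸ 4) seed ,
  trans (length-μ^-seed (k ∸ 4)) (cong (2 ^_) (m∸n+n≡m (<⇒≤ 5≤k))) ,
  extremal-μ^-seed (k ∸ 4) (∸-monoˡ-≤ 4 5≤k)
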